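{- For $n\ge 3$, the polynomial $P_{n,\underline{1}23}(x)=\sum_{\sigma\in S_n}x^{pmp_{\underline{1}23}(\sigma)}$ has degree $n-2$, and its coefficient of $x^{n-2}$ equals $(n-2)!$.
   Context: For $\sigma=\sigma_1\cdots\sigma_n\in S_n$, $\sigma$ has a $\underline{1}23$-match at position $\ell$ if there exist $j,m$ with $\ell<j<m$ and $\sigma_\ell<\sigma_j<\sigma_m$; $pmp_{\underline{1}23}(\sigma)$ is the number of positions $\ell$ at which $\sigma$ has a $\underline{1}23$-match. -}

module Defs where

open import Data.Nat using (ℕ)
open import Data.Fin using (Fin; toℕ; _<?_) renaming (_<_ to _<ᶠ_)
open import Data.Fin.Properties using (any?; all?) renaming (_≟_ to _≟ᶠ_)
open import Data.Vec using (Vec; lookup)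
open import Data.List using (List; length; filter)
open import Data.List using () renaming (map to mapL)
open import Data.Fin using () 
open import Data.Product using (Σ; ∃; _×_; _,_)
open import Relation.Binary.PropositionalEquality using (_≡_)
open import Relation.Nullary using (Dec; _×-dec_; _→-dec_)
open import Relation.Nullary.Decidable using (True)
import Data.List as L

-- A permutation σ ∈ S_n is represented in one-line notation σ₁⋯σₙ as a
-- vector of length n over Fin n whose entries are pairwise distinct.
IsPerm : ∀ {n} → Vec (Fin n) n → Set
IsPerm {n} v = ∀ (i j : Fin n) → lookup v i ≡ lookup v j → i ≡ j

isPerm? : ∀ {n} (v : Vec (Fin n) n) → Dec (IsPerm v)
isPerm? v = all? (λ i → all? (λ j → (lookup v i ≟ᶠ lookup v j) →-dec (i ≟ᶠ j)))

-- S_n: the proof component is a 'True' witness, so it carries no information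
-- (ensures the set-level counting below is meaningful without funext).
Perm : ℕ → Set
Perm n = Σ (Vec (Fin n) n) (λ v → True (isPerm? v))

Match123 : ∀ {n} → Vec (Fin n) n → Fin n → Set
Match123 {n} σ ℓ = ∃ λ (j : Fin n) → ∃ λ (m : Fin n) →
  (ℓ <ᶠ j) × (j <ᶠ m) × (lookup σ ℓ <ᶠ lookup σ j) × (lookup σ j <ᶠ lookup σ m)

match123? : ∀ {n} (σ : Vec (Fin n) n) (ℓ : Fin n) → Dec (Match123 σ ℓ)
match123? σ ℓ = any? λ j → any? λ m →
  (ℓ <? j) ×-dec (j <? m) ×-dec (lookup σ ℓ <? lookup σ j) ×-dec (lookup σ j <? lookup σ m)

pmp123 : ∀ {n} → Perm n → ℕ
pmp123 {n} (σ , _) = length (filter (match123? σ) (L.allFin n))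

-- The permutations counted by the coefficient of x^k in P_{n,1̲23}(x).
PermsWithPmp : ℕ → ℕ → Set
PermsWithPmp n k = Σ (Perm n) (λ σ → pmp123 σ ≡ k)

-- The last two positions n − 1 and n can never start a 1̲23-match, so pmp ≤ n − 2, with
-- equality exactly when every position ℓ ≤ n − 2 starts a match. Then σ_n = n: the value n
-- cannot sit at a matched position, nor at position n − 1, since the match at position n − 2
-- can only be completed by positions n − 1 < n and so forces σ_{n−1} < σ_n. Next σ_{n−1} = n − 1:
-- a matched position holding n − 1 would need the value n, i.e. position n, as its middle entry.
-- Conversely, if σ fixes n − 1 and n, these two positions complete a match at every earlier
-- position. So the permutations attaining pmp = n − 2 are those fixing the top two entries,
-- and deleting those entries is a bijection onto S_{n−2}.

module Submission where

open import Defs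
open import Data.Nat using (ℕ; zero; suc; _+_; _≤_; _<_; _∸_; _!; s≤s)
open import Data.Nat.Properties as ℕ using (≤⇒≯)
open import Data.Fin using (Fin; zero; suc; toℕ; fromℕ; inject₁; lower₁; punchIn; punchOut)
  renaming (_<_ to _<ᶠ_)
open import Data.Fin.Properties
  using ( toℕ-injective; toℕ-fromℕ; toℕ-inject₁; toℕ<n; ≤fromℕ; fromℕ≢inject₁; inject₁-injective
        ; inject₁-lower₁; suc-injective; 0≢1+n; punchOut-cong; punchOut-punchIn; punchIn-punchOut
        ; punchIn-injective; punchInᵢ≢i; punchOut-injective; injective⇒≤; any?; *↔×)
  renaming (_≟_ to _≟ᶠ_)
open import Data.Vec using (Vec; []; _∷_; _∷ʳ_; lookup; tabulate; map)
open import Data.Vec.Properties using (lookup∘tabulate; tabulate∘lookup; tabulate-cong; lookup-map)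
import Data.List as L
open import Data.List using (length; filter)
open import Data.List.Properties using (length-filter; filter-all; filter-notAll; filter-reject; length-tabulate)
import Data.List.Relation.Unary.All.Properties as All
import Data.List.Relation.Unary.Any.Properties as Any
open import Data.Product using (Σ; ∃; _×_; _,_; proj₁)
open import Data.Product.Algebra using (Σ-assoc)
open import Data.Product.Function.Dependent.Propositional using (Σ-↔)
open import Data.Unit using (tt)
open import Function using (_∘_; id)
open import Function.Bundles using (_↔_; _⇔_; mk↔ₛ′; mk⇔; Equivalence)
open import Function.Properties.Inverse using (↔-refl; ↔-sym; ↔-trans)
open import Function.Related.Propositional using (module EquationalReasoning)
open import Data.Product.Function.NonDependent.Propositional using (_×-↔_)
open import Axiom.UniquenessOfIdentityProofs using (UIP; module Decidable⇒UIP)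
open import Relation.Binary.PropositionalEquality
open import Relation.Nullary using (Dec; yes; no; ¬_; contradiction)
open import Relation.Nullary.Irrelevant using (Irrelevant)
open import Relation.Nullary.Decidable using (True; toWitness; fromWitness)
open import Relation.Unary using (Pred; Decidable)

module _ {a p} {A : Set a} {P : Pred A p} where

  Σ-≡ : (∀ {x} → Irrelevant (P x)) → ∀ {x y} {px : P x} {py : P y} → x ≡ y → (x , px) ≡ (y , py)
  Σ-≡ irr refl = cong (_ ,_) (irr _ _)

⇔⇒↔ : ∀ {a b} {A : Set a} {B : Set b} → Irrelevant A → Irrelevant B → A ⇔ B → A ↔ B
⇔⇒↔ irrA irrB A⇔B = mk↔ₛ′ to from (λ _ → irrB _ _) (λ _ → irrA _ _)
  where open Equivalence A⇔B

True-irrelevant : ∀ {a} {A : Set a} (a? : Dec A) → Irrelevant (True a?)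
True-irrelevant (yes _) _ _ = refl

Fin-≡-irrelevant : ∀ {n} → UIP (Fin n)
Fin-≡-irrelevant = Decidable⇒UIP.≡-irrelevant _≟ᶠ_

lookup-ext : ∀ {a} {A : Set a} {n} {v w : Vec A n} → (∀ i → lookup v i ≡ lookup w i) → v ≡ w
lookup-ext {v = v} {w} v≗w = trans (sym (tabulate∘lookup v)) (trans (tabulate-cong v≗w) (tabulate∘lookup w))

data LastView {n : ℕ} : Fin (suc n) → Set where
  at-inject₁ : (i : Fin n) → LastView (inject₁ i)
  at-fromℕ   : LastView (fromℕ n)

lastView : ∀ {n} (x : Fin (suc n)) → LastView x
lastView {zero}  zero    = at-fromℕ
lastView {suc n} zero    = at-inject₁ zero
lastView {suc n} (suc x) with lastView x
... | at-inject₁ i = at-inject₁ (suc i)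
... | at-fromℕ     = at-fromℕ

module _ {a} {A : Set a} where

  lookup-∷ʳ-inject₁ : ∀ {n} (xs : Vec A n) x i → lookup (xs ∷ʳ x) (inject₁ i) ≡ lookup xs i
  lookup-∷ʳ-inject₁ (_ ∷ _)  _ zero    = refl
  lookup-∷ʳ-inject₁ (_ ∷ xs) x (suc i) = lookup-∷ʳ-inject₁ xs x i

  lookup-∷ʳ-fromℕ : ∀ {n} (xs : Vec A n) x → lookup (xs ∷ʳ x) (fromℕ n) ≡ x
  lookup-∷ʳ-fromℕ []       _ = refl
  lookup-∷ʳ-fromℕ (_ ∷ xs) x = lookup-∷ʳ-fromℕ xs x

module _ {a p} {A : Set a} {P : Pred A p} (P? : Decidable P) where

  filter-tabulate-init : ∀ {n} (f : Fin (suc n) → A) → ¬ P (f (fromℕ n)) →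
                         filter P? (L.tabulate f) ≡ filter P? (L.tabulate (f ∘ inject₁))
  filter-tabulate-init {zero}  f ¬Pf = filter-reject P? ¬Pf
  filter-tabulate-init {suc n} f ¬Pf with P? (f zero)
  ... | yes _ = cong (f zero L.∷_) (filter-tabulate-init (f ∘ suc) ¬Pf)
  ... | no  _ = filter-tabulate-init (f ∘ suc) ¬Pf

  length-filter-tabulate≤ : ∀ {n} (f : Fin n → A) → length (filter P? (L.tabulate f)) ≤ n
  length-filter-tabulate≤ f =
    subst (length (filter P? (L.tabulate f)) ≤_) (length-tabulate f) (length-filter P? (L.tabulate f))

  length-filter-tabulate≡⇔ : ∀ {n} (f : Fin n → A) →
                             length (filter P? (L.tabulate f)) ≡ n ⇔ (∀ i → P (f i))
  length-filter-tabulate≡⇔ {n} f = mk⇔ all-satisfy all-kept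
    where
    all-satisfy : length (filter P? (L.tabulate f)) ≡ n → ∀ i → P (f i)
    all-satisfy eq i with P? (f i)
    ... | yes Pfi = Pfi
    ... | no ¬Pfi = contradiction eq (ℕ.<⇒≢ (subst (length (filter P? (L.tabulate f)) <_) (length-tabulate f)
                                     (filter-notAll P? (L.tabulate f) (Any.tabulate⁺ i ¬Pfi))))
    all-kept : (∀ i → P (f i)) → length (filter P? (L.tabulate f)) ≡ n
    all-kept Pf = trans (cong length (filter-all P? (All.tabulate⁺ Pf))) (length-tabulate f)

Perm-≡ : ∀ {n} {σ τ : Perm n} → proj₁ σ ≡ proj₁ τ → σ ≡ τ
Perm-≡ = Σ-≡ λ {v} → True-irrelevant (isPerm? v)

lookup-surjective : ∀ {n} {v : Vec (Fin n) n} → IsPerm v → ∀ y → ∃ λ x → lookup v x ≡ y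
lookup-surjective {zero} _ ()
lookup-surjective {suc n} {v} v-inj y with any? (λ x → lookup v x ≟ᶠ y)
... | yes found = found
... | no ¬found = contradiction (injective⇒≤ punchOut-inj) ℕ.1+n≰n
  where
  y≢v : ∀ x → y ≢ lookup v x
  y≢v x eq = ¬found (x , sym eq)
  punchOut-inj : ∀ {x x′} → punchOut (y≢v x) ≡ punchOut (y≢v x′) → x ≡ x′
  punchOut-inj eq = v-inj _ _ (punchOut-injective (y≢v _) (y≢v _) eq)

module _ {n : ℕ} where

  removeHead : Perm (suc n) → Fin (suc n) × Perm n
  removeHead (x ∷ xs , σ-perm) = x , (tabulate rest , fromWitness rest-inj)
    where
    σ-inj : IsPerm (x ∷ xs)
    σ-inj = toWitness σ-perm
    x≢xs : ∀ i → x ≢ lookup xs i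
    x≢xs i eq = 0≢1+n (σ-inj zero (suc i) eq)
    rest : Fin n → Fin n
    rest i = punchOut (x≢xs i)
    rest-inj : IsPerm (tabulate rest)
    rest-inj i j eq = suc-injective (σ-inj (suc i) (suc j) (punchOut-injective (x≢xs i) (x≢xs j)
      (trans (sym (lookup∘tabulate rest i)) (trans eq (lookup∘tabulate rest j)))))

  insertHead : Fin (suc n) × Perm n → Perm (suc n)
  insertHead (x , (τ , τ-perm)) = (x ∷ tabulate rest) , fromWitness σ-inj
    where
    rest : Fin n → Fin (suc n)
    rest i = punchIn x (lookup τ i)
    x≢rest : ∀ i → x ≢ lookup (tabulate rest) i
    x≢rest i eq = punchInᵢ≢i x (lookup τ i) (sym (trans eq (lookup∘tabulate rest i)))
    σ-inj : IsPerm (x ∷ tabulate rest)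
    σ-inj zero    zero    _  = refl
    σ-inj zero    (suc j) eq = contradiction eq (x≢rest j)
    σ-inj (suc i) zero    eq = contradiction (sym eq) (x≢rest i)
    σ-inj (suc i) (suc j) eq = cong suc (toWitness τ-perm i j (punchIn-injective x _ _
      (trans (sym (lookup∘tabulate rest i)) (trans eq (lookup∘tabulate rest j)))))

  Perm-suc↔ : Perm (suc n) ↔ (Fin (suc n) × Perm n)
  Perm-suc↔ = mk↔ₛ′ removeHead insertHead removeHead∘insertHead insertHead∘removeHead
    where
    removeHead∘insertHead : ∀ y → removeHead (insertHead y) ≡ y
    removeHead∘insertHead (x , τ) = cong (x ,_) (Perm-≡ (lookup-ext λ i →
      trans (lookup∘tabulate _ i) (trans (punchOut-cong x (lookup∘tabulate _ i)) (punchOut-punchIn x))))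
    insertHead∘removeHead : ∀ σ → insertHead (removeHead σ) ≡ σ
    insertHead∘removeHead (x ∷ xs , _) = Perm-≡ (cong (x ∷_) (lookup-ext λ i →
      trans (lookup∘tabulate _ i) (trans (cong (punchIn x) (lookup∘tabulate _ i)) (punchIn-punchOut _))))

Perm↔Fin! : ∀ n → Perm n ↔ Fin (n !)
Perm↔Fin! zero    =
  mk↔ₛ′ (λ _ → zero) (λ _ → [] , tt) (λ { zero → refl }) (λ { ([] , _) → Perm-≡ refl })
Perm↔Fin! (suc n) = ↔-trans Perm-suc↔ (↔-trans (↔-refl ×-↔ Perm↔Fin! n) (↔-sym (*↔× {suc n} {n !})))

Fixes : ∀ {n} → Perm n → Fin n → Set
Fixes (v , _) i = lookup v i ≡ i

PermFixingLast : ℕ → Set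
PermFixingLast n = Σ (Perm (suc n)) λ σ → Fixes σ (fromℕ n)

module Restriction {n : ℕ} (v : Vec (Fin (suc n)) (suc n)) (v-inj : IsPerm v)
                   (fixed : lookup v (fromℕ n) ≡ fromℕ n) where

  inner-not-last : ∀ i → n ≢ toℕ (lookup v (inject₁ i))
  inner-not-last i eq =
    fromℕ≢inject₁ (v-inj _ _ (trans fixed (toℕ-injective (trans (toℕ-fromℕ n) eq))))

  values : Vec (Fin n) n
  values = tabulate λ i → lower₁ (lookup v (inject₁ i)) (inner-not-last i)

  inject₁-values : ∀ i → inject₁ (lookup values i) ≡ lookup v (inject₁ i)
  inject₁-values i = trans (cong inject₁ (lookup∘tabulate _ i)) (inject₁-lower₁ _ _)

  values-inj : IsPerm values
  values-inj i j eq = inject₁-injective (v-inj _ _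
    (trans (sym (inject₁-values i)) (trans (cong inject₁ eq) (inject₁-values j))))

module _ {n : ℕ} where

  restrict : PermFixingLast n → Perm n
  restrict ((v , v-perm) , fixed) = values , fromWitness values-inj
    where open Restriction v (toWitness v-perm) fixed

  inject₁-restrict : ∀ s i →
    inject₁ (lookup (proj₁ (restrict s)) i) ≡ lookup (proj₁ (proj₁ s)) (inject₁ i)
  inject₁-restrict ((v , v-perm) , fixed) = Restriction.inject₁-values v (toWitness v-perm) fixed

  Fixes-inject₁⇔Fixes-restrict : ∀ s i → Fixes (proj₁ s) (inject₁ i) ⇔ Fixes (restrict s) i
  Fixes-inject₁⇔Fixes-restrict s i =
    mk⇔ (λ eq → inject₁-injective (trans (inject₁-restrict s i) eq))
        (λ eq → trans (sym (inject₁-restrict s i)) (cong inject₁ eq))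

  extension : Vec (Fin n) n → Vec (Fin (suc n)) (suc n)
  extension τ = map inject₁ τ ∷ʳ fromℕ n

  extension-inject₁ : ∀ τ i → lookup (extension τ) (inject₁ i) ≡ inject₁ (lookup τ i)
  extension-inject₁ τ i = trans (lookup-∷ʳ-inject₁ (map inject₁ τ) (fromℕ n) i) (lookup-map i inject₁ τ)

  extension-fromℕ : ∀ τ → lookup (extension τ) (fromℕ n) ≡ fromℕ n
  extension-fromℕ τ = lookup-∷ʳ-fromℕ (map inject₁ τ) (fromℕ n)

  extension-inj : ∀ {τ} → IsPerm τ → IsPerm (extension τ)
  extension-inj {τ} τ-inj x y eq = cases (lastView x) (lastView y) eq
    where
    cases : ∀ {x y} → LastView x → LastView y → lookup (extension τ) x ≡ lookup (extension τ) y → x ≡ y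
    cases (at-inject₁ i) (at-inject₁ j) eq = cong inject₁ (τ-inj i j (inject₁-injective
      (trans (sym (extension-inject₁ τ i)) (trans eq (extension-inject₁ τ j)))))
    cases (at-inject₁ i) at-fromℕ eq = contradiction
      (trans (sym (extension-fromℕ τ)) (trans (sym eq) (extension-inject₁ τ i))) fromℕ≢inject₁
    cases at-fromℕ (at-inject₁ j) eq = contradiction
      (trans (sym (extension-fromℕ τ)) (trans eq (extension-inject₁ τ j))) fromℕ≢inject₁
    cases at-fromℕ at-fromℕ _ = refl

  extend : Perm n → PermFixingLast n
  extend (τ , τ-perm) = (extension τ , fromWitness (extension-inj {τ} (toWitness τ-perm))) , extension-fromℕ τ

  PermFixingLast↔Perm : PermFixingLast n ↔ Perm n
  PermFixingLast↔Perm = mk↔ₛ′ restrict extend restrict∘extend extend∘restrict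
    where
    restrict∘extend : ∀ τ → restrict (extend τ) ≡ τ
    restrict∘extend τ = Perm-≡ (lookup-ext λ i → inject₁-injective
      (trans (inject₁-restrict (extend τ) i) (extension-inject₁ (proj₁ τ) i)))
    extend∘restrict : ∀ s → extend (restrict s) ≡ s
    extend∘restrict s@((v , _) , fixed) =
      Σ-≡ Fin-≡-irrelevant (Perm-≡ (lookup-ext λ x → agree (lastView x)))
      where
      agree : ∀ {x} → LastView x → lookup (extension (proj₁ (restrict s))) x ≡ lookup v x
      agree (at-inject₁ i) = trans (extension-inject₁ (proj₁ (restrict s)) i) (inject₁-restrict s i)
      agree at-fromℕ       = trans (extension-fromℕ (proj₁ (restrict s))) (sym fixed)

module _ {m : ℕ} where

  -- Indices are 0-based: these are the paper's positions (and values) n and n − 1.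
  last penult : Fin (suc (suc m))
  last   = fromℕ (suc m)
  penult = inject₁ (fromℕ m)

  inner : Fin m → Fin (suc (suc m))
  inner i = inject₁ (inject₁ i)

  data TopView : Fin (suc (suc m)) → Set where
    at-inner  : (i : Fin m) → TopView (inner i)
    at-penult : TopView penult
    at-last   : TopView last

  topView : (x : Fin (suc (suc m))) → TopView x
  topView x with lastView x
  ... | at-fromℕ = at-last
  ... | at-inject₁ y with lastView y
  ...   | at-inject₁ i = at-inner i
  ...   | at-fromℕ     = at-penult

  toℕ-inner : ∀ i → toℕ (inner i) ≡ toℕ i
  toℕ-inner i = trans (toℕ-inject₁ (inject₁ i)) (toℕ-inject₁ i)

  toℕ-penult : toℕ penult ≡ m
  toℕ-penult = trans (toℕ-inject₁ (fromℕ m)) (toℕ-fromℕ m)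

  inner<penult : ∀ i → inner i <ᶠ penult
  inner<penult i = subst₂ _<_ (sym (toℕ-inner i)) (sym toℕ-penult) (toℕ<n i)

  penult<last : penult <ᶠ last
  penult<last = subst₂ _<_ (sym toℕ-penult) (sym (toℕ-fromℕ (suc m))) (ℕ.n<1+n m)

  inner≢penult : ∀ i → inner i ≢ penult
  inner≢penult i eq = fromℕ≢inject₁ (sym (inject₁-injective eq))

  inner≢last : ∀ i → inner i ≢ last
  inner≢last i eq = fromℕ≢inject₁ (sym eq)

  last≢penult : last ≢ penult
  last≢penult = fromℕ≢inject₁

  nothing-above-last : ∀ {x} → ¬ (last <ᶠ x)
  nothing-above-last {x} = ≤⇒≯ (≤fromℕ x)

  above-penult : ∀ {x} → penult <ᶠ x → x ≡ last
  above-penult {x} penult<x = toℕ-injective (trans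
    (ℕ.≤-antisym (subst (toℕ x ≤_) (toℕ-fromℕ (suc m)) (≤fromℕ x))
                 (subst (_< toℕ x) toℕ-penult penult<x))
    (sym (toℕ-fromℕ (suc m))))

  below-penult : ∀ {x} → x ≢ penult → x ≢ last → x <ᶠ penult
  below-penult {x} x≢penult x≢last with topView x
  ... | at-inner i = inner<penult i
  ... | at-penult  = contradiction refl x≢penult
  ... | at-last    = contradiction refl x≢last

  no-match-at-last : ∀ {v} → ¬ Match123 v last
  no-match-at-last (_ , _ , last<j , _) = nothing-above-last last<j

  no-match-at-penult : ∀ {v} → ¬ Match123 v penult
  no-match-at-penult (_ , k , penult<j , j<k , _) = nothing-above-last (subst (_<ᶠ k) (above-penult penult<j) j<k)

  pmp123-inner : ∀ σ → pmp123 σ ≡ length (filter (match123? (proj₁ σ)) (L.tabulate inner))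
  pmp123-inner (v , _) = cong length (trans
    (filter-tabulate-init (match123? v) id (no-match-at-last {v = v}))
    (filter-tabulate-init (match123? v) inject₁ (no-match-at-penult {v = v})))

  pmp123≤ : ∀ σ → pmp123 σ ≤ m
  pmp123≤ σ = subst (_≤ m) (sym (pmp123-inner σ)) (length-filter-tabulate≤ (match123? (proj₁ σ)) inner)

  pmp123≡⇔ : ∀ σ → pmp123 σ ≡ m ⇔ (∀ i → Match123 (proj₁ σ) (inner i))
  pmp123≡⇔ σ = mk⇔ (to ∘ trans (sym (pmp123-inner σ))) (trans (pmp123-inner σ) ∘ from)
    where open Equivalence (length-filter-tabulate≡⇔ (match123? (proj₁ σ)) inner)

module _ {m₀ : ℕ} (v : Vec (Fin (3 + m₀)) (3 + m₀)) (v-inj : IsPerm v) where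

  AllInnerMatch : Set
  AllInnerMatch = ∀ i → Match123 v (inner i)

  penult<last-values : AllInnerMatch → lookup v penult <ᶠ lookup v last
  penult<last-values matches with matches (fromℕ m₀)
  ... | j , k , ℓ<j , j<k , _ , vj<vk = go (topView j) ℓ<j j<k vj<vk
    where
    go : ∀ {j} → TopView j → inner (fromℕ m₀) <ᶠ j → j <ᶠ k → lookup v j <ᶠ lookup v k →
         lookup v penult <ᶠ lookup v last
    go (at-inner i) ℓ<j _ _ =
      contradiction (subst₂ _<_ (toℕ-inner (fromℕ m₀)) (toℕ-inner i) ℓ<j) (≤⇒≯ (≤fromℕ i))
    go at-penult    _ j<k vj<vk = subst (λ k → lookup v penult <ᶠ lookup v k) (above-penult j<k) vj<vk
    go at-last      _ j<k _     = contradiction j<k nothing-above-last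

  fixes-last : AllInnerMatch → lookup v last ≡ last
  fixes-last matches with lookup-surjective {v = v} v-inj last
  ... | p , vp≡last = go (topView p) vp≡last
    where
    go : ∀ {p} → TopView p → lookup v p ≡ last → lookup v last ≡ last
    go (at-inner i) vp≡last with matches i
    ... | j , _ , _ , _ , vp<vj , _ = contradiction (subst (_<ᶠ lookup v j) vp≡last vp<vj) nothing-above-last
    go at-penult    vp≡last = contradiction
      (subst (_<ᶠ lookup v last) vp≡last (penult<last-values matches)) nothing-above-last
    go at-last      vp≡last = vp≡last

  fixes-penult : AllInnerMatch → lookup v penult ≡ penult
  fixes-penult matches with lookup-surjective {v = v} v-inj penult
  ... | q , vq≡penult = go (topView q) vq≡penult
    where
    go : ∀ {q} → TopView q → lookup v q ≡ penult → lookup v penult ≡ penult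
    go (at-inner i) vq≡penult with matches i
    ... | j , k , _ , j<k , vq<vj , _ = contradiction (subst (_<ᶠ k) j≡last j<k) nothing-above-last
      where
      j≡last : j ≡ last
      j≡last = v-inj j last (trans (above-penult (subst (_<ᶠ lookup v j) vq≡penult vq<vj))
                                   (sym (fixes-last matches)))
    go at-penult    vq≡penult = vq≡penult
    go at-last      vq≡penult = contradiction (trans (sym (fixes-last matches)) vq≡penult) last≢penult

  fixed-top⇒all-inner-match : lookup v last ≡ last → lookup v penult ≡ penult → AllInnerMatch
  fixed-top⇒all-inner-match last-fixed penult-fixed i =
    penult , last , inner<penult i , penult<last ,
    subst (lookup v (inner i) <ᶠ_) (sym penult-fixed) (below-penult vi≢penult vi≢last) ,
    subst₂ _<ᶠ_ (sym penult-fixed) (sym last-fixed) penult<last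
    where
    vi≢penult : lookup v (inner i) ≢ penult
    vi≢penult eq = inner≢penult i (v-inj _ _ (trans eq (sym penult-fixed)))
    vi≢last : lookup v (inner i) ≢ last
    vi≢last eq = inner≢last i (v-inj _ _ (trans eq (sym last-fixed)))

pmp123≡⇔fixes-top : ∀ {m₀} (σ : Perm (3 + m₀)) →
  pmp123 σ ≡ suc m₀ ⇔ (Fixes σ last × Fixes σ penult)
pmp123≡⇔fixes-top σ@(v , v-perm) = mk⇔
  (λ eq → let matches = to eq in fixes-last v v-inj matches , fixes-penult v v-inj matches)
  (λ (last-fixed , penult-fixed) → from (fixed-top⇒all-inner-match v v-inj last-fixed penult-fixed))
  where
  open Equivalence (pmp123≡⇔ σ)
  v-inj = toWitness v-perm

Fixes-top-irrelevant : ∀ {m} {σ : Perm (suc (suc m))} → Irrelevant (Fixes σ last × Fixes σ penult)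
Fixes-top-irrelevant (p , q) (p′ , q′) = cong₂ _,_ (Fin-≡-irrelevant p p′) (Fin-≡-irrelevant q q′)

PermsWithTopPmp↔fixing-top : ∀ m₀ →
  PermsWithPmp (3 + m₀) (suc m₀) ↔ Σ (Perm (3 + m₀)) (λ σ → Fixes σ last × Fixes σ penult)
PermsWithTopPmp↔fixing-top m₀ =
  Σ-↔ {A = λ σ → pmp123 σ ≡ suc m₀} {B = λ σ → Fixes σ last × Fixes σ penult} ↔-refl
  (λ {σ} → ⇔⇒↔ ℕ.≡-irrelevant (Fixes-top-irrelevant {σ = σ}) (pmp123≡⇔fixes-top σ))

fixing-penult↔PermFixingLast : ∀ m₀ →
  Σ (PermFixingLast (2 + m₀)) (λ s → Fixes (proj₁ s) penult) ↔ PermFixingLast (suc m₀)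
fixing-penult↔PermFixingLast m₀ =
  Σ-↔ {A = λ s → Fixes (proj₁ s) penult} {B = λ τ → Fixes τ (fromℕ (suc m₀))} PermFixingLast↔Perm
    (λ {s} → ⇔⇒↔ Fin-≡-irrelevant Fin-≡-irrelevant (Fixes-inject₁⇔Fixes-restrict s (fromℕ (suc m₀))))

PermsWithTopPmp↔Perm : ∀ m₀ → PermsWithPmp (3 + m₀) (suc m₀) ↔ Perm (suc m₀)
PermsWithTopPmp↔Perm m₀ = begin
  PermsWithPmp (3 + m₀) (suc m₀)                                 ↔⟨ PermsWithTopPmp↔fixing-top m₀ ⟩
  Σ (Perm (3 + m₀)) (λ σ → Fixes σ last × Fixes σ penult)         ↔⟨ ↔-sym Σ-assoc ⟩
  Σ (PermFixingLast (2 + m₀)) (λ s → Fixes (proj₁ s) penult)     ↔⟨ fixing-penult↔PermFixingLast m₀ ⟩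
  PermFixingLast (suc m₀)                                        ↔⟨ PermFixingLast↔Perm ⟩
  Perm (suc m₀)                                                  ∎
  where open EquationalReasoning

theorem4 : (n : ℕ) → 3 ≤ n →
    ((k : ℕ) → n ∸ 2 < k → ¬ PermsWithPmp n k)
    × (PermsWithPmp n (n ∸ 2) ↔ Fin ((n ∸ 2) !))
theorem4 (suc (suc (suc m₀))) _ =
    (λ k m<k (σ , pmp≡k) → ≤⇒≯ (subst (_≤ suc m₀) pmp≡k (pmp123≤ σ)) m<k)
  , ↔-trans (PermsWithTopPmp↔Perm m₀) (Perm↔Fin! (suc m₀))
theorem4 (suc zero)       (s≤s ())
theorem4 (suc (suc zero)) (s≤s (s≤s ()))
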